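{- Let $\mathbf{A}$ be a complete BL-algebra and $\mathcal{P}=\langle W,\pi\rangle$ a possibilistic $\mathbf{A}$-frame. Then the complex $\mathbf{A}$-algebra $\langle\mathbf{A}^W,\forall^{\mathcal{P}},\exists^{\mathcal{P}}\rangle$ is an Epistemic BL-algebra, and $\pi$ is its focal element, i.e. $\pi=\min\{f\in A^W:\forall^{\mathcal{P}}f=1\}$; thus it is a c-EBL-algebra with $c=\pi$.
   Context: A BL-algebra is an algebra $\langle A,\wedge,\vee,\ast,\to,0,1\rangle$ such that $\langle A,\wedge,\vee,0,1\rangle$ is a bounded lattice (order $\le$), $\langle A,\ast,1\rangle$ is a commutative monoid, $a\ast b\le c$ iff $a\le b\to c$, and $a\wedge b=a\ast(a\to b)$ and $(a\to b)\vee(b\to a)=1$ hold; it is complete if every subset has a supremum and an infimum. An Epistemic BL-algebra is a BL-algebra with unary operations $\forall,\exists$ satisfying, for all $a,b$: $\forall 1=1$; $\exists 0=0$; $\forall a\to\exists a=1$; $\forall(a\to\forall b)=\exists a\to\forall b$; $\forall(\forall a\to b)=\forall a\to\forall b$; $\exists a\to\forall\exists a=1$; $\forall(a\wedge b)=\forall a\wedge\forall b$; $\exists(a\vee b)=\exists a\vee\exists b$; $\exists(a\ast\exists b)=\exists a\ast\exists b$. The focal element of an EBL-algebra is the least element of $\{a:\forall a=1\}$ when it exists; a c-EBL-algebra is one where it exists. A possibilistic $\mathbf{A}$-frame is a pair $\langle W,\pi\rangle$ with $W$ a non-empty set and $\pi:W\to A$ satisfying $\sup_{w\in W}\pi(w)=1$.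 $\mathbf{A}^W$ is the BL-algebra of all functions $W\to A$ with pointwise operations. For $f\in A^W$, $\forall^{\mathcal{P}}f$ is the constant function with value $\inf_{w\in W}\{\pi(w)\to f(w)\}$ and $\exists^{\mathcal{P}}f$ is the constant function with value $\sup_{w\in W}\{\pi(w)\ast f(w)\}$. -}

module Defs where

open import Level using (Level; _⊔_; suc)
open import Data.Product using (Σ; _×_; _,_)
open import Relation.Binary.Core using (Rel)
open import Algebra.Core using (Op₁; Op₂)
open import Algebra.Structures using (IsCommutativeMonoid)
open import Algebra.Lattice.Structures using (IsLattice)
open import Algebra.Definitions using (Congruent₂)

module _ {c ℓ : Level} {A : Set c} (_≈_ : Rel A ℓ) where

  record IsBLAlgebra (_∧_ _∨_ _*_ _⇒_ : Op₂ A) (𝟘 𝟙 : A) : Set (c ⊔ ℓ) where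
    _≤_ : A → A → Set ℓ
    a ≤ b = (a ∧ b) ≈ a
    field
      isLattice           : IsLattice _≈_ _∨_ _∧_
      bottom              : ∀ a → 𝟘 ≤ a
      top                 : ∀ a → a ≤ 𝟙
      isCommutativeMonoid : IsCommutativeMonoid _≈_ _*_ 𝟙
      ⇒-cong              : Congruent₂ _≈_ _⇒_
      residuation         : ∀ a b d → ((a * b) ≤ d → a ≤ (b ⇒ d)) × (a ≤ (b ⇒ d) → (a * b) ≤ d)
      divisibility        : ∀ a b → (a ∧ b) ≈ (a * (a ⇒ b))
      prelinearity        : ∀ a b → ((a ⇒ b) ∨ (b ⇒ a)) ≈ 𝟙

record BLAlgebra (c ℓ : Level) : Set (suc (c ⊔ ℓ)) where
  infix  4 _≈_
  field
    Carrier     : Set c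
    _≈_         : Rel Carrier ℓ
    _∧_ _∨_ _*_ _⇒_ : Op₂ Carrier
    𝟘 𝟙         : Carrier
    isBLAlgebra : IsBLAlgebra _≈_ _∧_ _∨_ _*_ _⇒_ 𝟘 𝟙
  open IsBLAlgebra isBLAlgebra public

module _ {c ℓ : Level} (𝐀 : BLAlgebra c ℓ) where
  open BLAlgebra 𝐀

  Subset : Set (suc (c ⊔ ℓ))
  Subset = Carrier → Set (c ⊔ ℓ)

  IsSup : Subset → Carrier → Set (c ⊔ ℓ)
  IsSup S s = (∀ x → S x → x ≤ s) × (∀ u → (∀ x → S x → x ≤ u) → s ≤ u)

  IsInf : Subset → Carrier → Set (c ⊔ ℓ)
  IsInf S s = (∀ x → S x → s ≤ x) × (∀ u → (∀ x → S x → u ≤ x) → u ≤ s)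

  record IsComplete : Set (suc (c ⊔ ℓ)) where
    field
      sup    : Subset → Carrier
      inf    : Subset → Carrier
      sup-is : ∀ S → IsSup S (sup S)
      inf-is : ∀ S → IsInf S (inf S)

module _ {c ℓ : Level} {A : Set c} (_≈_ : Rel A ℓ)
         (_∧_ _∨_ _*_ _⇒_ : Op₂ A) (𝟘 𝟙 : A) where

  record IsEpistemic (∀' ∃' : Op₁ A) : Set (c ⊔ ℓ) where
    field
      ∀-𝟙   : ∀' 𝟙 ≈ 𝟙
      ∃-𝟘   : ∃' 𝟘 ≈ 𝟘
      ∀⇒∃   : ∀ a → (∀' a ⇒ ∃' a) ≈ 𝟙
      ax4   : ∀ a b → ∀' (a ⇒ ∀' b) ≈ (∃' a ⇒ ∀' b)
      ax5   : ∀ a b → ∀' (∀' a ⇒ b) ≈ (∀' a ⇒ ∀' b)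
      ax6   : ∀ a → (∃' a ⇒ ∀' (∃' a)) ≈ 𝟙
      ∀-∧   : ∀ a b → ∀' (a ∧ b) ≈ (∀' a ∧ ∀' b)
      ∃-∨   : ∀ a b → ∃' (a ∨ b) ≈ (∃' a ∨ ∃' b)
      ∃-*∃  : ∀ a b → ∃' (a * ∃' b) ≈ (∃' a * ∃' b)

  IsFocal : (∀' : Op₁ A) → A → Set (c ⊔ ℓ)
  IsFocal ∀' f = (∀' f ≈ 𝟙) × (∀ a → ∀' a ≈ 𝟙 → (f ∧ a) ≈ f)

module Complex {c ℓ : Level} (𝐀 : BLAlgebra c ℓ) (cpl : IsComplete 𝐀)
               (W : Set c) (π : W → BLAlgebra.Carrier 𝐀) where
  open BLAlgebra 𝐀
  open IsComplete cpl

  IsPossibilisticFrame : Set ℓ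
  IsPossibilisticFrame = sup (λ a → Σ W λ w → a ≈ π w) ≈ 𝟙

  F : Set c
  F = W → Carrier

  _≈ᶠ_ : Rel F (c ⊔ ℓ)
  f ≈ᶠ g = ∀ w → f w ≈ g w

  _∧ᶠ_ _∨ᶠ_ _*ᶠ_ _⇒ᶠ_ : Op₂ F
  (f ∧ᶠ g) w = f w ∧ g w
  (f ∨ᶠ g) w = f w ∨ g w
  (f *ᶠ g) w = f w * g w
  (f ⇒ᶠ g) w = f w ⇒ g w

  𝟘ᶠ 𝟙ᶠ : F
  𝟘ᶠ _ = 𝟘
  𝟙ᶠ _ = 𝟙

  ∀ᴾ ∃ᴾ : Op₁ F
  ∀ᴾ f _ = inf (λ a → Σ W λ w → a ≈ (π w ⇒ f w))
  ∃ᴾ f _ = sup (λ a → Σ W λ w → a ≈ (π w * f w))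

-- Every axiom of the complex algebra reduces, at each world, to an
-- identity about indexed infima and suprema in 𝐀 that holds in any complete
-- BL-algebra: _⇒_ turns suprema in its first argument and infima in its
-- second into infima, and _*_ preserves suprema.  The only axiom that needs
-- the frame condition ⨆ π ≈ 𝟙 is ∀ a ≤ ∃ a: writing 𝟙 ≈ ⨆ π * ⨆ π, it is
-- enough to bound (∀ a) * π w * π v, and prelinearity gives
-- π w * π v ≤ (π w * π w) ∨ (π v * π v), while (∀ a) * π u ≤ a u.
-- Finally ∀ a ≈ 𝟙 holds iff π ≤ a pointwise, which makes π the focal element.
module Submission where

open import Defs
open import Level using (Level)
open import Data.Product using (_×_; _,_; proj₁; proj₂; Σ)
open import Algebra.Lattice.Bundles using (Lattice)
import Algebra.Lattice.Properties.Lattice as LatticeProperties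
open import Algebra.Structures using (IsCommutativeMonoid)
open import Algebra.Lattice.Structures using (IsLattice)
open import Relation.Binary.Bundles using (Poset)
import Relation.Binary.Lattice.Structures as Order
import Relation.Binary.Reasoning.PartialOrder as ≤-Reasoning
import Algebra.Construct.Pointwise as Pointwise

module BLProperties {c ℓ : Level} (𝐀 : BLAlgebra c ℓ) where
  open BLAlgebra 𝐀
  open IsLattice isLattice public
    using (isEquivalence; refl; sym)
  open IsCommutativeMonoid isCommutativeMonoid public
    using (∙-cong; assoc; comm; identityˡ; identityʳ)

  private
    lattice : Lattice c ℓ
    lattice = record { isLattice = isLattice }

    open LatticeProperties lattice using (poset; ∨-∧-isOrderTheoreticLattice)
    module ⊑ = Poset poset
    module ⊑-Lattice = Order.IsLattice ∨-∧-isOrderTheoreticLattice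

    -- the library orders a lattice by x ≈ x ∧ y, which is _≤_ up to sym
    fromLibrary : ∀ {x y} → x ⊑.≤ y → x ≤ y
    fromLibrary = sym

    toLibrary : ∀ {x y} → x ≤ y → x ⊑.≤ y
    toLibrary = sym

  ≤-reflexive : ∀ {x y} → x ≈ y → x ≤ y
  ≤-reflexive x≈y = fromLibrary (⊑.reflexive x≈y)

  ≤-refl : ∀ {x} → x ≤ x
  ≤-refl = ≤-reflexive refl

  ≤-trans : ∀ {x y z} → x ≤ y → y ≤ z → x ≤ z
  ≤-trans x≤y y≤z = fromLibrary (⊑.trans (toLibrary x≤y) (toLibrary y≤z))

  ≤-antisym : ∀ {x y} → x ≤ y → y ≤ x → x ≈ y
  ≤-antisym x≤y y≤x = ⊑.antisym (toLibrary x≤y) (toLibrary y≤x)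

  ≤-poset : Poset c ℓ ℓ
  ≤-poset = record
    { isPartialOrder = record
      { isPreorder = record
        { isEquivalence = isEquivalence ; reflexive = ≤-reflexive ; trans = ≤-trans }
      ; antisym = ≤-antisym
      }
    }

  x∧y≤x : ∀ x y → (x ∧ y) ≤ x
  x∧y≤x x y = fromLibrary (⊑-Lattice.x∧y≤x x y)

  x∧y≤y : ∀ x y → (x ∧ y) ≤ y
  x∧y≤y x y = fromLibrary (⊑-Lattice.x∧y≤y x y)

  ∧-greatest : ∀ {x y z} → x ≤ y → x ≤ z → x ≤ (y ∧ z)
  ∧-greatest x≤y x≤z = fromLibrary (⊑-Lattice.∧-greatest (toLibrary x≤y) (toLibrary x≤z))

  x≤x∨y : ∀ x y → x ≤ (x ∨ y)
  x≤x∨y x y = fromLibrary (⊑-Lattice.x≤x∨y x y)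

  y≤x∨y : ∀ x y → y ≤ (x ∨ y)
  y≤x∨y x y = fromLibrary (⊑-Lattice.y≤x∨y x y)

  ∨-least : ∀ {x y z} → x ≤ z → y ≤ z → (x ∨ y) ≤ z
  ∨-least x≤z y≤z = fromLibrary (⊑-Lattice.∨-least (toLibrary x≤z) (toLibrary y≤z))

  𝟙≤⇒≈𝟙 : ∀ {x} → 𝟙 ≤ x → x ≈ 𝟙
  𝟙≤⇒≈𝟙 𝟙≤x = ≤-antisym (top _) 𝟙≤x

  curry : ∀ {a b d} → (a * b) ≤ d → a ≤ (b ⇒ d)
  curry = proj₁ (residuation _ _ _)

  uncurry : ∀ {a b d} → a ≤ (b ⇒ d) → (a * b) ≤ d
  uncurry = proj₂ (residuation _ _ _)

  curryˡ : ∀ {a b d} → (a * b) ≤ d → b ≤ (a ⇒ d)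
  curryˡ ab≤d = curry (≤-trans (≤-reflexive (comm _ _)) ab≤d)

  uncurryˡ : ∀ {a b d} → b ≤ (a ⇒ d) → (a * b) ≤ d
  uncurryˡ b≤a⇒d = ≤-trans (≤-reflexive (comm _ _)) (uncurry b≤a⇒d)

  modus-ponens : ∀ a b → ((a ⇒ b) * a) ≤ b
  modus-ponens a b = uncurry ≤-refl

  *-monoˡ-≤ : ∀ {a b} x → a ≤ b → (a * x) ≤ (b * x)
  *-monoˡ-≤ x a≤b = uncurry (≤-trans a≤b (curry ≤-refl))

  *-monoʳ-≤ : ∀ x {a b} → a ≤ b → (x * a) ≤ (x * b)
  *-monoʳ-≤ x a≤b = uncurryˡ (≤-trans a≤b (curryˡ ≤-refl))

  ⇒-monoʳ-≤ : ∀ x {a b} → a ≤ b → (x ⇒ a) ≤ (x ⇒ b)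
  ⇒-monoʳ-≤ x a≤b = curry (≤-trans (modus-ponens x _) a≤b)

  x*y≤x : ∀ x y → (x * y) ≤ x
  x*y≤x x y = ≤-trans (*-monoʳ-≤ x (top y)) (≤-reflexive (identityʳ x))

  *-zeroʳ : ∀ x → (x * 𝟘) ≈ 𝟘
  *-zeroʳ x = ≤-antisym (uncurryˡ (bottom _)) (bottom _)

  ≤⇒𝟙≤⇒ : ∀ {x y} → x ≤ y → 𝟙 ≤ (x ⇒ y)
  ≤⇒𝟙≤⇒ x≤y = curry (≤-trans (≤-reflexive (identityˡ _)) x≤y)

  𝟙≤⇒⇒≤ : ∀ {x y} → 𝟙 ≤ (x ⇒ y) → x ≤ y
  𝟙≤⇒⇒≤ 𝟙≤x⇒y = ≤-trans (≤-reflexive (sym (identityˡ _))) (uncurry 𝟙≤x⇒y)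

  ⇒-curry : ∀ a b d → ((a * b) ⇒ d) ≈ (a ⇒ (b ⇒ d))
  ⇒-curry a b d = ≤-antisym
    (curry (curry (≤-trans (≤-reflexive (assoc _ a b)) (modus-ponens _ d))))
    (curry (≤-trans (≤-reflexive (sym (assoc _ a b))) (uncurry (uncurry ≤-refl))))

  ⇒-exchange : ∀ a b d → (a ⇒ (b ⇒ d)) ≈ (b ⇒ (a ⇒ d))
  ⇒-exchange a b d = begin-equality
    a ⇒ (b ⇒ d)  ≈⟨ sym (⇒-curry a b d) ⟩
    (a * b) ⇒ d  ≈⟨ ⇒-cong (comm a b) refl ⟩
    (b * a) ⇒ d  ≈⟨ ⇒-curry b a d ⟩
    b ⇒ (a ⇒ d)  ∎
    where open ≤-Reasoning ≤-poset

  ⇒-distribˡ-∧ : ∀ x a b → (x ⇒ (a ∧ b)) ≈ ((x ⇒ a) ∧ (x ⇒ b))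
  ⇒-distribˡ-∧ x a b = ≤-antisym
    (∧-greatest (⇒-monoʳ-≤ x (x∧y≤x a b)) (⇒-monoʳ-≤ x (x∧y≤y a b)))
    (curry (∧-greatest (uncurry (x∧y≤x _ _)) (uncurry (x∧y≤y _ _))))

  *-distribˡ-∨ : ∀ x a b → (x * (a ∨ b)) ≈ ((x * a) ∨ (x * b))
  *-distribˡ-∨ x a b = ≤-antisym
    (uncurryˡ (∨-least (curryˡ (x≤x∨y _ _)) (curryˡ (y≤x∨y _ _))))
    (∨-least (*-monoʳ-≤ x (x≤x∨y a b)) (*-monoʳ-≤ x (y≤x∨y a b)))

  -- Multiply by (a ⇒ b) ∨ (b ⇒ a) ≈ 𝟙 and use a * (a ⇒ b) ≤ b, b * (b ⇒ a) ≤ a.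
  x*y≤x*x∨y*y : ∀ a b → (a * b) ≤ ((a * a) ∨ (b * b))
  x*y≤x*x∨y*y a b = begin
    a * b                                    ≈⟨ sym (identityʳ _) ⟩
    (a * b) * 𝟙                              ≈⟨ ∙-cong refl (sym (prelinearity a b)) ⟩
    (a * b) * ((a ⇒ b) ∨ (b ⇒ a))            ≈⟨ *-distribˡ-∨ _ _ _ ⟩
    ((a * b) * (a ⇒ b)) ∨ ((a * b) * (b ⇒ a)) ≤⟨ ∨-least b-case a-case ⟩
    (a * a) ∨ (b * b)                        ∎
    where
    open ≤-Reasoning ≤-poset
    b-case : ((a * b) * (a ⇒ b)) ≤ ((a * a) ∨ (b * b))
    b-case = begin
      (a * b) * (a ⇒ b)  ≈⟨ ∙-cong (comm a b) refl ⟩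
      (b * a) * (a ⇒ b)  ≈⟨ assoc b a _ ⟩
      b * (a * (a ⇒ b))  ≤⟨ *-monoʳ-≤ b (uncurryˡ ≤-refl) ⟩
      b * b              ≤⟨ y≤x∨y _ _ ⟩
      (a * a) ∨ (b * b)  ∎
    a-case : ((a * b) * (b ⇒ a)) ≤ ((a * a) ∨ (b * b))
    a-case = begin
      (a * b) * (b ⇒ a)  ≈⟨ assoc a b _ ⟩
      a * (b * (b ⇒ a))  ≤⟨ *-monoʳ-≤ a (uncurryˡ ≤-refl) ⟩
      a * a              ≤⟨ x≤x∨y _ _ ⟩
      (a * a) ∨ (b * b)  ∎

module IndexedBounds {c ℓ : Level} (𝐀 : BLAlgebra c ℓ) (cpl : IsComplete 𝐀)
                     (W : Set c) where
  open BLAlgebra 𝐀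
  open BLProperties 𝐀
  open IsComplete cpl

  ⨅ ⨆ : (W → Carrier) → Carrier
  ⨅ g = inf (λ a → Σ W λ w → a ≈ g w)
  ⨆ g = sup (λ a → Σ W λ w → a ≈ g w)

  ⨅-lower : ∀ g w → ⨅ g ≤ g w
  ⨅-lower g w = proj₁ (inf-is _) (g w) (w , refl)

  ⨅-greatest : ∀ g {x} → (∀ w → x ≤ g w) → x ≤ ⨅ g
  ⨅-greatest g {x} x≤g = proj₂ (inf-is _) x λ where
    _ (w , a≈gw) → ≤-trans (x≤g w) (≤-reflexive (sym a≈gw))

  ⨆-upper : ∀ g w → g w ≤ ⨆ g
  ⨆-upper g w = proj₁ (sup-is _) (g w) (w , refl)

  ⨆-least : ∀ g {x} → (∀ w → g w ≤ x) → ⨆ g ≤ x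
  ⨆-least g {x} g≤x = proj₂ (sup-is _) x λ where
    _ (w , a≈gw) → ≤-trans (≤-reflexive a≈gw) (g≤x w)

  ⨅-cong : ∀ {g h} → (∀ w → g w ≈ h w) → ⨅ g ≈ ⨅ h
  ⨅-cong {g} {h} g≈h = ≤-antisym
    (⨅-greatest h λ w → ≤-trans (⨅-lower g w) (≤-reflexive (g≈h w)))
    (⨅-greatest g λ w → ≤-trans (⨅-lower h w) (≤-reflexive (sym (g≈h w))))

  ⨆-cong : ∀ {g h} → (∀ w → g w ≈ h w) → ⨆ g ≈ ⨆ h
  ⨆-cong {g} {h} g≈h = ≤-antisym
    (⨆-least g λ w → ≤-trans (≤-reflexive (g≈h w)) (⨆-upper h w))
    (⨆-least h λ w → ≤-trans (≤-reflexive (sym (g≈h w))) (⨆-upper g w))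

  ⨅-∧ : ∀ g h → ⨅ (λ w → g w ∧ h w) ≈ (⨅ g ∧ ⨅ h)
  ⨅-∧ g h = ≤-antisym
    (∧-greatest (⨅-greatest g λ w → ≤-trans (⨅-lower _ w) (x∧y≤x _ _))
                (⨅-greatest h λ w → ≤-trans (⨅-lower _ w) (x∧y≤y _ _)))
    (⨅-greatest _ λ w → ∧-greatest (≤-trans (x∧y≤x _ _) (⨅-lower g w))
                                   (≤-trans (x∧y≤y _ _) (⨅-lower h w)))

  ⨆-∨ : ∀ g h → ⨆ (λ w → g w ∨ h w) ≈ (⨆ g ∨ ⨆ h)
  ⨆-∨ g h = ≤-antisym
    (⨆-least _ λ w → ∨-least (≤-trans (⨆-upper g w) (x≤x∨y _ _))
                             (≤-trans (⨆-upper h w) (y≤x∨y _ _)))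
    (∨-least (⨆-least g λ w → ≤-trans (x≤x∨y _ _) (⨆-upper _ w))
             (⨆-least h λ w → ≤-trans (y≤x∨y _ _) (⨆-upper _ w)))

  ⨆-*-⨆-least : ∀ g h {x} → (∀ w v → (g w * h v) ≤ x) → (⨆ g * ⨆ h) ≤ x
  ⨆-*-⨆-least g h gh≤x =
    uncurry (⨆-least g λ w → curry (uncurryˡ (⨆-least h λ v → curryˡ (gh≤x w v))))

  ⨆-*ʳ : ∀ g x → (⨆ g * x) ≈ ⨆ (λ w → g w * x)
  ⨆-*ʳ g x = ≤-antisym
    (uncurry (⨆-least g λ w → curry (⨆-upper _ w)))
    (⨆-least _ λ w → *-monoˡ-≤ x (⨆-upper g w))

  ⨆-⇒ : ∀ g x → (⨆ g ⇒ x) ≈ ⨅ (λ w → g w ⇒ x)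
  ⨆-⇒ g x = ≤-antisym
    (⨅-greatest _ λ w → curry (≤-trans (*-monoʳ-≤ _ (⨆-upper g w)) (modus-ponens _ x)))
    (curry (uncurryˡ (⨆-least g λ w → curryˡ (uncurry (⨅-lower _ w)))))

  ⇒-⨅ : ∀ x g → (x ⇒ ⨅ g) ≈ ⨅ (λ w → x ⇒ g w)
  ⇒-⨅ x g = ≤-antisym
    (⨅-greatest _ λ w → ⇒-monoʳ-≤ x (⨅-lower g w))
    (curry (⨅-greatest g λ w → uncurry (⨅-lower _ w)))

pointwise-isBLAlgebra : ∀ {c ℓ} (𝐀 : BLAlgebra c ℓ) (W : Set c) →
  let open BLAlgebra 𝐀 in
  IsBLAlgebra (λ f g → ∀ w → f w ≈ g w)
    (λ f g w → f w ∧ g w) (λ f g w → f w ∨ g w)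
    (λ f g w → f w * g w) (λ f g w → f w ⇒ g w) (λ _ → 𝟘) (λ _ → 𝟙)
pointwise-isBLAlgebra 𝐀 W = record
  { isLattice = record
    { isEquivalence = Pointwise.isEquivalence W isEquivalence
    ; ∨-comm        = λ f g w → ∨-comm (f w) (g w)
    ; ∨-assoc       = λ f g h w → ∨-assoc (f w) (g w) (h w)
    ; ∨-cong        = λ f≈f′ g≈g′ w → ∨-cong (f≈f′ w) (g≈g′ w)
    ; ∧-comm        = λ f g w → ∧-comm (f w) (g w)
    ; ∧-assoc       = λ f g h w → ∧-assoc (f w) (g w) (h w)
    ; ∧-cong        = λ f≈f′ g≈g′ w → ∧-cong (f≈f′ w) (g≈g′ w)
    ; absorptive    = (λ f g w → proj₁ absorptive (f w) (g w))
                    , (λ f g w → proj₂ absorptive (f w) (g w))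
    }
  ; bottom              = λ f w → bottom (f w)
  ; top                 = λ f w → top (f w)
  ; isCommutativeMonoid = Pointwise.isCommutativeMonoid W isCommutativeMonoid
  ; ⇒-cong              = λ f≈f′ g≈g′ w → ⇒-cong (f≈f′ w) (g≈g′ w)
  ; residuation         = λ f g h → (λ fg≤h w → proj₁ (residuation _ _ _) (fg≤h w))
                                  , (λ f≤g⇒h w → proj₂ (residuation _ _ _) (f≤g⇒h w))
  ; divisibility        = λ f g w → divisibility (f w) (g w)
  ; prelinearity        = λ f g w → prelinearity (f w) (g w)
  }
  where
  open BLAlgebra 𝐀
  open IsLattice isLattice

module PossibilisticFrame {c ℓ : Level} (𝐀 : BLAlgebra c ℓ) (cpl : IsComplete 𝐀)
                          (W : Set c) (π : W → BLAlgebra.Carrier 𝐀)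
                          (frame : Complex.IsPossibilisticFrame 𝐀 cpl W π) where
  open BLAlgebra 𝐀
  open BLProperties 𝐀
  open IndexedBounds 𝐀 cpl W
  open Complex 𝐀 cpl W π using (_≈ᶠ_; _∧ᶠ_; _∨ᶠ_; _*ᶠ_; _⇒ᶠ_; 𝟘ᶠ; 𝟙ᶠ; ∀ᴾ; ∃ᴾ)
  open ≤-Reasoning ≤-poset

  necessity possibility : (W → Carrier) → Carrier
  necessity f = ⨅ (λ w → π w ⇒ f w)
  possibility f = ⨆ (λ w → π w * f w)

  necessity*π≤ : ∀ f w → (necessity f * π w) ≤ f w
  necessity*π≤ f w = uncurry (⨅-lower _ w)

  π≤⇒necessity≈𝟙 : ∀ {f} → (∀ w → π w ≤ f w) → necessity f ≈ 𝟙
  π≤⇒necessity≈𝟙 π≤f = 𝟙≤⇒≈𝟙 (⨅-greatest _ λ w → ≤⇒𝟙≤⇒ (π≤f w))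

  necessity≈𝟙⇒π≤ : ∀ {f} → necessity f ≈ 𝟙 → ∀ w → π w ≤ f w
  necessity≈𝟙⇒π≤ N≈𝟙 w = 𝟙≤⇒⇒≤ (≤-trans (≤-reflexive (sym N≈𝟙)) (⨅-lower _ w))

  necessity≤possibility : ∀ f → necessity f ≤ possibility f
  necessity≤possibility f = 𝟙≤⇒⇒≤ (begin
    𝟙                ≈⟨ sym (identityˡ 𝟙) ⟩
    𝟙 * 𝟙            ≈⟨ ∙-cong (sym frame) (sym frame) ⟩
    ⨆ π * ⨆ π        ≤⟨ ⨆-*-⨆-least π π (λ w v → curryˡ (pair w v)) ⟩
    α ⇒ possibility f ∎)
    where
    α = necessity f
    square : ∀ u → (α * (π u * π u)) ≤ possibility f
    square u = begin
      α * (π u * π u)  ≈⟨ sym (assoc α _ _) ⟩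
      (α * π u) * π u  ≤⟨ *-monoˡ-≤ (π u) (necessity*π≤ f u) ⟩
      f u * π u        ≈⟨ comm _ _ ⟩
      π u * f u        ≤⟨ ⨆-upper _ u ⟩
      possibility f    ∎
    pair : ∀ w v → (α * (π w * π v)) ≤ possibility f
    pair w v = begin
      α * (π w * π v)                          ≤⟨ *-monoʳ-≤ α (x*y≤x*x∨y*y (π w) (π v)) ⟩
      α * ((π w * π w) ∨ (π v * π v))          ≈⟨ *-distribˡ-∨ α _ _ ⟩
      (α * (π w * π w)) ∨ (α * (π v * π v))    ≤⟨ ∨-least (square w) (square v) ⟩
      possibility f                            ∎

  possibility-𝟘 : possibility (λ _ → 𝟘) ≈ 𝟘
  possibility-𝟘 = ≤-antisym (⨆-least _ λ w → ≤-reflexive (*-zeroʳ (π w))) (bottom _)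

  necessity-⇒ʳ : ∀ f x → necessity (λ w → f w ⇒ x) ≈ (possibility f ⇒ x)
  necessity-⇒ʳ f x = begin-equality
    ⨅ (λ w → π w ⇒ (f w ⇒ x))  ≈⟨ ⨅-cong (λ w → sym (⇒-curry (π w) (f w) x)) ⟩
    ⨅ (λ w → (π w * f w) ⇒ x)  ≈⟨ sym (⨆-⇒ _ x) ⟩
    possibility f ⇒ x          ∎

  necessity-⇒ˡ : ∀ x f → necessity (λ w → x ⇒ f w) ≈ (x ⇒ necessity f)
  necessity-⇒ˡ x f = begin-equality
    ⨅ (λ w → π w ⇒ (x ⇒ f w))  ≈⟨ ⨅-cong (λ w → ⇒-exchange (π w) x (f w)) ⟩
    ⨅ (λ w → x ⇒ (π w ⇒ f w))  ≈⟨ sym (⇒-⨅ x _) ⟩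
    x ⇒ necessity f            ∎

  ≤necessity-const : ∀ x → x ≤ necessity (λ _ → x)
  ≤necessity-const x = ⨅-greatest _ λ w → curry (x*y≤x x (π w))

  necessity-∧ : ∀ f g → necessity (λ w → f w ∧ g w) ≈ (necessity f ∧ necessity g)
  necessity-∧ f g = begin-equality
    ⨅ (λ w → π w ⇒ (f w ∧ g w))             ≈⟨ ⨅-cong (λ w → ⇒-distribˡ-∧ (π w) (f w) (g w)) ⟩
    ⨅ (λ w → (π w ⇒ f w) ∧ (π w ⇒ g w))     ≈⟨ ⨅-∧ _ _ ⟩
    necessity f ∧ necessity g               ∎

  possibility-∨ : ∀ f g → possibility (λ w → f w ∨ g w) ≈ (possibility f ∨ possibility g)
  possibility-∨ f g = begin-equality
    ⨆ (λ w → π w * (f w ∨ g w))             ≈⟨ ⨆-cong (λ w → *-distribˡ-∨ (π w) (f w) (g w)) ⟩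
    ⨆ (λ w → (π w * f w) ∨ (π w * g w))     ≈⟨ ⨆-∨ _ _ ⟩
    possibility f ∨ possibility g           ∎

  possibility-*ʳ : ∀ f x → possibility (λ w → f w * x) ≈ (possibility f * x)
  possibility-*ʳ f x = begin-equality
    ⨆ (λ w → π w * (f w * x))  ≈⟨ ⨆-cong (λ w → sym (assoc (π w) (f w) x)) ⟩
    ⨆ (λ w → (π w * f w) * x)  ≈⟨ sym (⨆-*ʳ _ x) ⟩
    possibility f * x          ∎

  isEpistemic : IsEpistemic _≈ᶠ_ _∧ᶠ_ _∨ᶠ_ _*ᶠ_ _⇒ᶠ_ 𝟘ᶠ 𝟙ᶠ ∀ᴾ ∃ᴾ
  isEpistemic = record
    { ∀-𝟙  = λ _ → π≤⇒necessity≈𝟙 (λ w → top (π w))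
    ; ∃-𝟘  = λ _ → possibility-𝟘
    ; ∀⇒∃  = λ f _ → 𝟙≤⇒≈𝟙 (≤⇒𝟙≤⇒ (necessity≤possibility f))
    ; ax4  = λ f g _ → necessity-⇒ʳ f (necessity g)
    ; ax5  = λ f g _ → necessity-⇒ˡ (necessity f) g
    ; ax6  = λ f _ → 𝟙≤⇒≈𝟙 (≤⇒𝟙≤⇒ (≤necessity-const (possibility f)))
    ; ∀-∧  = λ f g _ → necessity-∧ f g
    ; ∃-∨  = λ f g _ → possibility-∨ f g
    ; ∃-*∃ = λ f g _ → possibility-*ʳ f (possibility g)
    }

  π-isFocal : IsFocal _≈ᶠ_ _∧ᶠ_ _∨ᶠ_ _*ᶠ_ _⇒ᶠ_ 𝟘ᶠ 𝟙ᶠ ∀ᴾ π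
  π-isFocal = (λ _ → π≤⇒necessity≈𝟙 (λ _ → ≤-refl))
            , (λ f ∀ᴾf≈𝟙 w → necessity≈𝟙⇒π≤ (∀ᴾf≈𝟙 w) w)

theorem9 : {c ℓ : Level} (𝐀 : BLAlgebra c ℓ) (cpl : IsComplete 𝐀)
    (W : Set c) (w₀ : W) (π : W → BLAlgebra.Carrier 𝐀) →
    Complex.IsPossibilisticFrame 𝐀 cpl W π →
    let open Complex 𝐀 cpl W π in
    IsBLAlgebra _≈ᶠ_ _∧ᶠ_ _∨ᶠ_ _*ᶠ_ _⇒ᶠ_ 𝟘ᶠ 𝟙ᶠ
    × IsEpistemic _≈ᶠ_ _∧ᶠ_ _∨ᶠ_ _*ᶠ_ _⇒ᶠ_ 𝟘ᶠ 𝟙ᶠ ∀ᴾ ∃ᴾ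
    × IsFocal _≈ᶠ_ _∧ᶠ_ _∨ᶠ_ _*ᶠ_ _⇒ᶠ_ 𝟘ᶠ 𝟙ᶠ ∀ᴾ π
theorem9 𝐀 cpl W _ π frame = pointwise-isBLAlgebra 𝐀 W , isEpistemic , π-isFocal
  where open PossibilisticFrame 𝐀 cpl W π frame
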